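{- Let $G$ be a graph and $(V_b,V_r)$ a partition of $V(G)$. Let $X\subseteq V_b$ be a set for which there is a one-to-one function $\psi: X\to V_b\setminus X$ such that (1) for every $x\in X$, $\psi(x)\notin N[x]$; (2) for any two vertices $x_1,x_2\in X$, $\psi(x_2)\notin N(x_1)$; and (3) for any two distinct vertices $x_1,x_2\in X$, $N[\psi(x_1)]\cap N[\psi(x_2)]=\emptyset$. Consider the reduction algorithm that outputs the instance $G(V_b',V_r')$ with $V_b'=V_b\setminus N[X]$ and $V_r'=V_r\cup N[X]$, together with the solution lifting algorithm that, given a solution $S'$ of $G(V_b',V_r')$, returns $S'\cup X$ as a solution of $G(V_b,V_r)$. These two algorithms together constitute a $2$-approximate reduction rule for the (generalized) Dominating Set problem; that is, for every solution $S'$ of $G(V_b',V_r')$, $$\frac{\mathrm{DS}(G(V_b,V_r),S'\cup X)}{\mathrm{OPT}(G(V_b,V_r))}\le 2\cdot\frac{\mathrm{DS}(G(V_b',V_r'),S')}{\mathrm{OPT}(G(V_b',V_r'))}.$$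
   Context: Graphs are finite, undirected and simple. $N(v)$ is the set of neighbours of $v$, $N[v]=N(v)\cup\{v\}$, and for $S\subseteq V(G)$, $N[S]=\bigcup_{w\in S}N[w]$. An instance of the generalized Dominating Set problem is a graph $G$ together with a partition $(V_b,V_r)$ of $V(G)$, written $G(V_b,V_r)$. A solution is any vertex set $S\subseteq V(G)$, with value $\mathrm{DS}(G(V_b,V_r),S)=\infty$ if $V_b\not\subseteq N[S]$ and $\mathrm{DS}(G(V_b,V_r),S)=|S|$ otherwise; $\mathrm{OPT}(G(V_b,V_r))$ is the minimum value over all solutions. For a real $\alpha\ge 1$, an $\alpha$-approximate reduction rule is a pair of polynomial-time algorithms: a reduction algorithm mapping an instance $I$ to an instance $I'$, and a solution lifting algorithm that, given $I$, $I'$ and any solution $S'$ of $I'$, computes a solution $S$ of $I$ with $\mathrm{DS}(I,S)/\mathrm{OPT}(I)\le \alpha\cdot \mathrm{DS}(I',S')/\mathrm{OPT}(I')$. -}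

module Defs where

open import Data.Nat using (ℕ; _≤_)
open import Data.Bool using (Bool; T)
open import Data.Fin using (Fin)
open import Data.Fin.Subset using (Subset; _∈_; _∉_; ∣_∣)
open import Data.Product using (Σ; _×_; ∃)
open import Data.Sum using (_⊎_)
open import Relation.Nullary using (¬_)
open import Relation.Binary.PropositionalEquality using (_≡_; _≢_)

record Graph : Set where
  field
    n      : ℕ
    adj    : Fin n → Fin n → Bool
    sym    : ∀ u v → T (adj u v) → T (adj v u)
    irrefl : ∀ v → ¬ T (adj v v)

open Graph public

Vertex : Graph → Set
Vertex G = Fin (n G)

VSet : Graph → Set
VSet G = Subset (n G)

Adj : (G : Graph) → Vertex G → Vertex G → Set
Adj G u v = T (adj G u v)

InClosedNbh : (G : Graph) → Vertex G → Vertex G → Set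
InClosedNbh G v w = v ≡ w ⊎ Adj G w v

InN[_] : (G : Graph) → VSet G → Vertex G → Set
InN[ G ] S v = Σ (Vertex G) (λ w → w ∈ S × InClosedNbh G v w)

-- A set of blue vertices is given as a predicate on vertices; the red set
-- V_r is its complement (it plays no role in the value DS).
-- S is feasible (DS(G(V_b,V_r),S) = |S| < ∞) iff V_b ⊆ N[S].
Dominates : (G : Graph) → (Vertex G → Set) → VSet G → Set
Dominates G Vb S = ∀ v → Vb v → InN[ G ] S v

IsOPT : (G : Graph) → (Vertex G → Set) → ℕ → Set
IsOPT G Vb m =
  (Σ (VSet G) (λ S → Dominates G Vb S × ∣ S ∣ ≡ m))
  × (∀ S → Dominates G Vb S → m ≤ ∣ S ∣)

-- The hypotheses on X ⊆ V_b and ψ : X → V_b ∖ X.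
-- ψ is given as a function on all vertices; only its values on X matter.
GoodPair : (G : Graph) → VSet G → VSet G → (Vertex G → Vertex G) → Set
GoodPair G Vb X ψ =
  (∀ x → x ∈ X → x ∈ Vb)
  × (∀ x → x ∈ X → ψ x ∈ Vb × ψ x ∉ X)
  × (∀ x₁ x₂ → x₁ ∈ X → x₂ ∈ X → ψ x₁ ≡ ψ x₂ → x₁ ≡ x₂)
  × (∀ x → x ∈ X → ¬ InClosedNbh G (ψ x) x)
  × (∀ x₁ x₂ → x₁ ∈ X → x₂ ∈ X → ¬ Adj G x₁ (ψ x₂))
  × (∀ x₁ x₂ → x₁ ∈ X → x₂ ∈ X → x₁ ≢ x₂ →
       ∀ v → ¬ (InClosedNbh G v (ψ x₁) × InClosedNbh G v (ψ x₂)))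

ReducedBlue : (G : Graph) → VSet G → VSet G → Vertex G → Set
ReducedBlue G Vb X v = v ∈ Vb × ¬ InN[ G ] X v

-- S′ ∪ X is feasible because X dominates N[X] and S′ dominates the rest of V_b.
-- For the ratio: OPT′ ≤ OPT since V_b′ ⊆ V_b, and |X| ≤ OPT since the closed
-- neighbourhoods N[ψ(x)] are pairwise disjoint, so the vertices ψ(x) need distinct
-- dominators. Hence |S′ ∪ X| · OPT′ ≤ |S′| · OPT′ + |X| · OPT′ ≤ |S′| · OPT + OPT · |S′|.
module Submission where

open import Defs hiding (sym)
open import Data.Nat using (ℕ; zero; suc; _+_; _*_; _≤_; z≤n; s≤s)
open import Data.Nat.Properties as ℕ using ()
open import Data.Fin using (Fin; _≟_) renaming (zero to fzero; suc to fsuc)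
open import Data.Fin.Properties using (any?)
open import Data.Fin.Subset
  using (Subset; inside; outside; ⊥; _∈_; _∉_; _∪_; _-_; ∣_∣)
open import Data.Fin.Subset.Properties
  using (_∈?_; p⊆p∪q; q⊆p∪q; p─⊥≡p; x∈p∧x≢y⇒x∈p-y; x∈p⇒∣p-x∣<∣p∣; p─q⊆p;
         nonempty?; Empty-unique; ∣⊥∣≡0)
open import Data.Vec using (_∷_; []; here; there)
open import Data.Product using (_×_; _,_; proj₁; proj₂)
open import Data.Sum using (inj₁; inj₂)
open import Data.Empty using (⊥-elim)
open import Relation.Nullary using (Dec; yes; no; ¬_)
open import Relation.Nullary.Decidable using (_×-dec_; _⊎-dec_)
open import Relation.Nullary.Decidable.Core using (T?)
open import Relation.Binary.PropositionalEquality
  using (_≡_; _≢_; refl; sym; trans; cong; subst; module ≡-Reasoning)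

∣p∪q∣≤∣p∣+∣q∣ : ∀ {n} (p q : Subset n) → ∣ p ∪ q ∣ ≤ ∣ p ∣ + ∣ q ∣
∣p∪q∣≤∣p∣+∣q∣ []            []            = z≤n
∣p∪q∣≤∣p∣+∣q∣ (outside ∷ p) (outside ∷ q) = ∣p∪q∣≤∣p∣+∣q∣ p q
∣p∪q∣≤∣p∣+∣q∣ (inside  ∷ p) (outside ∷ q) = s≤s (∣p∪q∣≤∣p∣+∣q∣ p q)
∣p∪q∣≤∣p∣+∣q∣ (outside ∷ p) (inside  ∷ q) =
  subst (suc ∣ p ∪ q ∣ ≤_) (sym (ℕ.+-suc ∣ p ∣ ∣ q ∣)) (s≤s (∣p∪q∣≤∣p∣+∣q∣ p q))
∣p∪q∣≤∣p∣+∣q∣ (inside  ∷ p) (inside  ∷ q) =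
  s≤s (subst (∣ p ∪ q ∣ ≤_) (sym (ℕ.+-suc ∣ p ∣ ∣ q ∣)) (ℕ.m≤n⇒m≤1+n (∣p∪q∣≤∣p∣+∣q∣ p q)))

x∉p-x : ∀ {n} (x : Fin n) (p : Subset n) → x ∉ p - x
x∉p-x fzero    (_ ∷ p) ()
x∉p-x (fsuc x) (_ ∷ p) (there x∈p-x) = x∉p-x x p x∈p-x

x∈p⇒∣p∣≡1+∣p-x∣ : ∀ {n} {x : Fin n} {p : Subset n} → x ∈ p → ∣ p ∣ ≡ suc ∣ p - x ∣
x∈p⇒∣p∣≡1+∣p-x∣ {p = inside  ∷ p} here        = cong (λ r → suc ∣ r ∣) (sym (p─⊥≡p p))
x∈p⇒∣p∣≡1+∣p-x∣ {p = inside  ∷ p} (there x∈p) = cong suc (x∈p⇒∣p∣≡1+∣p-x∣ x∈p)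
x∈p⇒∣p∣≡1+∣p-x∣ {p = outside ∷ p} (there x∈p) = x∈p⇒∣p∣≡1+∣p-x∣ x∈p

injection⇒∣p∣≤∣q∣ : ∀ {m n} (p : Subset m) (q : Subset n) (f : ∀ x → x ∈ p → Fin n)
  → (∀ x x∈p → f x x∈p ∈ q)
  → (∀ x y x∈p y∈p → f x x∈p ≡ f y y∈p → x ≡ y)
  → ∣ p ∣ ≤ ∣ q ∣
injection⇒∣p∣≤∣q∣ p q f f∈q f-inj = go ∣ p ∣ p q f f∈q f-inj refl
  where
  go : ∀ {m n} k (p : Subset m) (q : Subset n) (f : ∀ x → x ∈ p → Fin n)
     → (∀ x x∈p → f x x∈p ∈ q)
     → (∀ x y x∈p y∈p → f x x∈p ≡ f y y∈p → x ≡ y)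
     → ∣ p ∣ ≡ k → ∣ p ∣ ≤ ∣ q ∣
  go zero p q f f∈q f-inj ∣p∣≡0 = subst (_≤ ∣ q ∣) (sym ∣p∣≡0) z≤n
  go {m} (suc k) p q f f∈q f-inj ∣p∣≡1+k with nonempty? p
  ... | no empty = ⊥-elim (ℕ.0≢1+n (begin
    0         ≡⟨ sym (∣⊥∣≡0 m) ⟩
    ∣ ⊥ {m} ∣ ≡⟨ cong ∣_∣ (sym (Empty-unique empty)) ⟩
    ∣ p ∣     ≡⟨ ∣p∣≡1+k ⟩
    suc k     ∎))
    where open ≡-Reasoning
  ... | yes (x , x∈p) = begin
    ∣ p ∣               ≡⟨ x∈p⇒∣p∣≡1+∣p-x∣ x∈p ⟩
    suc ∣ p - x ∣       ≤⟨ s≤s ∣p-x∣≤∣q-fx∣ ⟩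
    suc ∣ q - f x x∈p ∣ ≤⟨ x∈p⇒∣p-x∣<∣p∣ (f∈q x x∈p) ⟩
    ∣ q ∣               ∎
    where
    open ℕ.≤-Reasoning
    f-restricted : ∀ y → y ∈ p - x → Fin _
    f-restricted y y∈p-x = f y (p─q⊆p p _ y∈p-x)
    ∣p-x∣≤∣q-fx∣ : ∣ p - x ∣ ≤ ∣ q - f x x∈p ∣
    ∣p-x∣≤∣q-fx∣ = go k (p - x) (q - f x x∈p) f-restricted
      (λ y y∈p-x → x∈p∧x≢y⇒x∈p-y (f∈q y _)
        λ fy≡fx → x∉p-x x p (subst (_∈ p - x) (f-inj y x _ x∈p fy≡fx) y∈p-x))
      (λ y z _ _ → f-inj y z _ _)
      (ℕ.suc-injective (trans (sym (x∈p⇒∣p∣≡1+∣p-x∣ x∈p)) ∣p∣≡1+k))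

u≤s+k⇒u*o′≤2*s*o : ∀ {u s k o o′} → u ≤ s + k → k ≤ o → o′ ≤ s → o′ ≤ o → u * o′ ≤ 2 * s * o
u≤s+k⇒u*o′≤2*s*o {u} {s} {k} {o} {o′} u≤s+k k≤o o′≤s o′≤o = begin
  u * o′           ≤⟨ ℕ.*-monoˡ-≤ o′ u≤s+k ⟩
  (s + k) * o′     ≡⟨ ℕ.*-distribʳ-+ o′ s k ⟩
  s * o′ + k * o′  ≤⟨ ℕ.+-mono-≤ (ℕ.*-monoʳ-≤ s o′≤o) (ℕ.*-mono-≤ k≤o o′≤s) ⟩
  s * o + o * s    ≡⟨ cong (s * o +_) (ℕ.*-comm o s) ⟩
  s * o + s * o    ≡⟨ cong (s * o +_) (sym (ℕ.+-identityʳ (s * o))) ⟩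
  2 * (s * o)      ≡⟨ sym (ℕ.*-assoc 2 s o) ⟩
  2 * s * o        ∎
  where open ℕ.≤-Reasoning

module _ (G : Graph) where

  closedNbh-sym : ∀ {v w} → InClosedNbh G v w → InClosedNbh G w v
  closedNbh-sym (inj₁ v≡w)  = inj₁ (sym v≡w)
  closedNbh-sym (inj₂ w~v) = inj₂ (Graph.sym G _ _ w~v)

  inN? : (S : VSet G) (v : Vertex G) → Dec (InN[ G ] S v)
  inN? S v = any? λ w → (w ∈? S) ×-dec ((v ≟ w) ⊎-dec T? (adj G w v))

  Dominates-weaken : ∀ {B B′ : Vertex G → Set} {S}
    → (∀ v → B′ v → B v) → Dominates G B S → Dominates G B′ S
  Dominates-weaken B′⊆B S-dom v v∈B′ = S-dom v (B′⊆B v v∈B′)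

  IsOPT-mono : ∀ {B B′ : Vertex G → Set} {opt opt′}
    → (∀ v → B′ v → B v) → IsOPT G B opt → IsOPT G B′ opt′ → opt′ ≤ opt
  IsOPT-mono B′⊆B ((S , S-dom , ∣S∣≡opt) , _) (_ , opt′-min) =
    subst (_ ≤_) ∣S∣≡opt (opt′-min S (Dominates-weaken B′⊆B S-dom))

  ∪-dominates : ∀ {B : Vertex G → Set} {S X}
    → Dominates G (λ v → B v × ¬ InN[ G ] X v) S → Dominates G B (S ∪ X)
  ∪-dominates {S = S} {X} S-dom v v∈B with inN? X v
  ... | yes (w , w∈X , v∈N[w]) = w , q⊆p∪q S X w∈X , v∈N[w]
  ... | no  v∉N[X] with S-dom v (v∈B , v∉N[X])
  ...   | w , w∈S , v∈N[w] = w , p⊆p∪q X w∈S , v∈N[w]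

  disjointClosedNbhs⇒∣X∣≤∣D∣ : ∀ {B : Vertex G → Set} {X D} (ψ : Vertex G → Vertex G)
    → (∀ x → x ∈ X → B (ψ x))
    → (∀ x₁ x₂ → x₁ ∈ X → x₂ ∈ X → x₁ ≢ x₂ →
         ∀ v → ¬ (InClosedNbh G v (ψ x₁) × InClosedNbh G v (ψ x₂)))
    → Dominates G B D → ∣ X ∣ ≤ ∣ D ∣
  disjointClosedNbhs⇒∣X∣≤∣D∣ {X = X} {D} ψ ψ∈B disjoint D-dom =
    injection⇒∣p∣≤∣q∣ X D dominator (λ x x∈X → proj₁ (proj₂ (dominates x x∈X))) dominator-injective
    where
    dominates : ∀ x → x ∈ X → InN[ G ] D (ψ x)
    dominates x x∈X = D-dom (ψ x) (ψ∈B x x∈X)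
    dominator : ∀ x → x ∈ X → Vertex G
    dominator x x∈X = proj₁ (dominates x x∈X)
    dominator-in-N[ψ] : ∀ x x∈X → InClosedNbh G (dominator x x∈X) (ψ x)
    dominator-in-N[ψ] x x∈X = closedNbh-sym (proj₂ (proj₂ (dominates x x∈X)))
    dominator-injective : ∀ x y x∈X y∈X → dominator x x∈X ≡ dominator y y∈X → x ≡ y
    dominator-injective x y x∈X y∈X same with x ≟ y
    ... | yes x≡y = x≡y
    ... | no  x≢y = ⊥-elim (disjoint x y x∈X y∈X x≢y _
      (dominator-in-N[ψ] x x∈X , subst (λ w → InClosedNbh G w (ψ y)) (sym same) (dominator-in-N[ψ] y y∈X)))

lemma4 : (G : Graph) (Vb X : VSet G) (ψ : Vertex G → Vertex G)
    → GoodPair G Vb X ψ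
    → (opt opt' : ℕ)
    → IsOPT G (λ v → v ∈ Vb) opt
    → IsOPT G (ReducedBlue G Vb X) opt'
    → (S' : VSet G)
    → Dominates G (ReducedBlue G Vb X) S'
    → Dominates G (λ v → v ∈ Vb) (S' ∪ X)
    × ∣ S' ∪ X ∣ * opt' ≤ 2 * ∣ S' ∣ * opt
lemma4 G Vb X ψ (_ , ψ∈Vb∖X , _ , _ , _ , disjoint)
       opt opt' Vb-opt@((O , O-dom , ∣O∣≡opt) , _) reduced-opt S' S'-dom =
  ∪-dominates G S'-dom ,
  u≤s+k⇒u*o′≤2*s*o (∣p∪q∣≤∣p∣+∣q∣ S' X) ∣X∣≤opt (proj₂ reduced-opt S' S'-dom) opt'≤opt
  where
  opt'≤opt : opt' ≤ opt
  opt'≤opt = IsOPT-mono G (λ _ → proj₁) Vb-opt reduced-opt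
  ∣X∣≤opt : ∣ X ∣ ≤ opt
  ∣X∣≤opt = subst (∣ X ∣ ≤_) ∣O∣≡opt
    (disjointClosedNbhs⇒∣X∣≤∣D∣ G ψ (λ x x∈X → proj₁ (ψ∈Vb∖X x x∈X)) disjoint O-dom)
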